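{- Let $k\geq 2$ and $n\geq m\geq 1$ be integers. The complete bipartite graph $K_{m,n}$ is a $\mathsf{TS}_k$-reconfiguration graph if and only if either ($m=1$ and $n\leq k$) or $m=n=2$.
   Context: All graphs are finite, simple and undirected. $K_{m,n}$ is the complete bipartite graph with parts of sizes $m$ and $n$. An independent set of a graph is a set of pairwise non-adjacent vertices. For a positive integer $k$, $\mathsf{TS}_k(G)$ is the graph whose vertices are the independent sets of $G$ of size exactly $k$, where two such sets $I,J$ are adjacent iff there exist $u,v\in V(G)$ with $I\setminus J=\{u\}$, $J\setminus I=\{v\}$ and $uv\in E(G)$. A graph $F$ is a $\mathsf{TS}_k$-reconfiguration graph if there exists a graph $G$ with $F\simeq \mathsf{TS}_k(G)$. -}

module Defs where

open import Data.Nat using (ℕ; _+_; _<ᵇ_)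
open import Data.Bool using (Bool; true; false; _xor_)
open import Data.Fin using (Fin; toℕ)
open import Data.Fin.Subset using (Subset; _∈_; ∣_∣; _─_; ⁅_⁆)
open import Data.Product using (Σ; ∃; ∃-syntax; _×_)
open import Relation.Binary.PropositionalEquality using (_≡_; refl)

record SimpleGraph (N : ℕ) : Set where
  field
    Adj   : Fin N → Fin N → Bool
    sym   : ∀ u v → Adj u v ≡ Adj v u
    irrefl : ∀ u → Adj u u ≡ false
open SimpleGraph public

Independent : ∀ {N} → SimpleGraph N → Subset N → Set
Independent G I = ∀ u v → u ∈ I → v ∈ I → Adj G u v ≡ false

TSVertex : ∀ {N} → ℕ → SimpleGraph N → Subset N → Set
TSVertex k G I = Independent G I × ∣ I ∣ ≡ k

TSAdj : ∀ {N} → SimpleGraph N → Subset N → Subset N → Set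
TSAdj G I J = ∃[ u ] ∃[ v ] ((I ─ J ≡ ⁅ u ⁆) × (J ─ I ≡ ⁅ v ⁆) × (Adj G u v ≡ true))

IsoToTS : ∀ {M N} → SimpleGraph M → ℕ → SimpleGraph N → Set
IsoToTS {M} {N} F k G =
  Σ (Fin M → Subset N) λ f →
    (∀ x → TSVertex k G (f x)) ×
    (∀ x y → f x ≡ f y → x ≡ y) ×
    (∀ I → TSVertex k G I → ∃[ x ] f x ≡ I) ×
    (∀ x y → (Adj F x y ≡ true → TSAdj G (f x) (f y)) ×
             (TSAdj G (f x) (f y) → Adj F x y ≡ true))

IsTSReconf : ∀ {M} → ℕ → SimpleGraph M → Set
IsTSReconf k F = ∃[ N ] Σ (SimpleGraph N) λ G → IsoToTS F k G

-- Complete bipartite graph K_{m,n} on Fin (m + n): the first m vertices form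
-- one part, the remaining n vertices the other.
kAdj : (m n : ℕ) → Fin (m + n) → Fin (m + n) → Bool
kAdj m n x y = (toℕ x <ᵇ m) xor (toℕ y <ᵇ m)


private
  xor-comm : ∀ a b → a xor b ≡ b xor a
  xor-comm false false = refl
  xor-comm false true  = refl
  xor-comm true  false = refl
  xor-comm true  true  = refl

  xor-self : ∀ a → a xor a ≡ false
  xor-self false = refl
  xor-self true  = refl

K : (m n : ℕ) → SimpleGraph (m + n)
K m n = record
  { Adj    = kAdj m n
  ; sym    = λ x y → xor-comm (toℕ x <ᵇ m) (toℕ y <ᵇ m)
  ; irrefl = λ x → xor-self (toℕ x <ᵇ m)
  }

module Submission where

-- Adjacent vertices of TS_k(G) differ by a swap X ↦ X - u + v along an edge uv.  If two
-- non-adjacent neighbours X - a + b₁ and X - a + b₂ of X swap out the same token a, then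
-- (k ≥ 2) trading a second token c of X for b₂ in X - a + b₁ gives an independent k-set W
-- containing b₁ and b₂, which is neither X nor adjacent to X.
--
-- In K_{1,n} the centre is adjacent to everything, so the n leaves swap out pairwise distinct
-- tokens of the centre and n ≤ k.  In K_{m,n} with m ≥ 2 and n ≥ 3 take X₁, X₂ on the m-side
-- and three common neighbours Y₀, Y₁, Y₂.  If X₂ is a single swap of X₁, every common
-- neighbour swaps out the same token of X₁, and the W built from Y₀, Y₁ is adjacent to
-- neither X₁ nor Y₂, although every vertex of K_{m,n} is adjacent to one of them.  Otherwise
-- X₁ and X₂ differ in two tokens on each side, and a common neighbour is determined by which
-- of the two tokens of X₁ ∖ X₂ it keeps, so there are at most two.
--
-- Conversely K_{1,n} (n ≤ k) is TS_k of k independent centres and an n-clique of leaves, each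
-- leaf joined to its own centre; K_{2,2} is TS_{2+j} of two disjoint edges and j isolated
-- vertices.

open import Defs hiding (sym)
open import Data.Bool using (Bool; true; false; not; _∧_; if_then_else_)
open import Data.Empty using (⊥; ⊥-elim)
open import Data.Fin using (Fin; zero; suc; _≟_; #_; toℕ; _↑ˡ_; _↑ʳ_; splitAt; inject≤)
open import Data.Fin.Properties
  using ( suc-injective; 0≢1+n; <⇒≢; pigeonhole; any?; all?; toℕ-↑ˡ; toℕ-↑ʳ
        ; splitAt-↑ˡ; splitAt-↑ʳ; splitAt⁻¹-↑ˡ; splitAt⁻¹-↑ʳ; ↑ˡ-injective; ↑ʳ-injective
        ; inject≤-injective )
open import Data.Fin.Subset using (Subset; ∣_∣; _─_; ⁅_⁆; _⊆_; ⊤) renaming (⊥ to ∅)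
open import Data.Fin.Subset.Properties
  using (drop-∷-⊆; p⊆q⇒∣p∣≤∣q∣; ∣p∣≤n; ∣⊤∣≡n; ∣⊥∣≡0; ∣p∣≡n⇒p≡⊤)
open import Data.Nat using (ℕ; _≤_; _≥_; _<_; _+_; _<ᵇ_; zero; suc; z≤n; s≤s; s≤s⁻¹)
import Data.Nat.Properties as ℕ
open import Data.Product using (_×_; ∃-syntax; _,_; proj₁; proj₂)
open import Data.Sum using (_⊎_; inj₁; inj₂; [_,_]′)
open import Data.Unit using (tt)
open import Data.Vec using (_∷_; []; _++_; lookup; tabulate; _[_]≔_; here; there)
import Data.Vec.Properties as Vec
open import Function using (_∘_)
open import Function.Bundles using (_⇔_; mk⇔)
open import Relation.Binary.PropositionalEquality
  using (_≡_; _≢_; refl; sym; trans; cong; cong₂; subst; subst₂; module ≡-Reasoning)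
open import Relation.Nullary using (¬_; yes; no; does)
open import Relation.Nullary.Decidable using (dec-true; dec-false; toWitness; _→-dec_)

private variable
  N k : ℕ

true≡false-elim : {A : Set} {b : Bool} → b ≡ true → b ≡ false → A
true≡false-elim refl ()

lookup-ext : {p q : Subset N} → (∀ x → lookup p x ≡ lookup q x) → p ≡ q
lookup-ext {p = p} {q} p≗q = begin
  p                   ≡⟨ Vec.tabulate∘lookup p ⟨
  tabulate (lookup p) ≡⟨ Vec.tabulate-cong p≗q ⟩
  tabulate (lookup q) ≡⟨ Vec.tabulate∘lookup q ⟩
  q                   ∎
  where open ≡-Reasoning

lookup-─ : (p q : Subset N) (x : Fin N) →
           lookup (p ─ q) x ≡ (if lookup q x then false else lookup p x)
lookup-─ (_ ∷ _) (true  ∷ _) zero    = refl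
lookup-─ (_ ∷ _) (false ∷ _) zero    = refl
lookup-─ (_ ∷ p) (_ ∷ q)     (suc x) = lookup-─ p q x

lookup-⁅x⁆-x : (x : Fin N) → lookup ⁅ x ⁆ x ≡ true
lookup-⁅x⁆-x zero    = refl
lookup-⁅x⁆-x (suc x) = lookup-⁅x⁆-x x

lookup-⁅x⁆-y : {x y : Fin N} → y ≢ x → lookup ⁅ x ⁆ y ≡ false
lookup-⁅x⁆-y {x = zero}  {zero}  y≢x = ⊥-elim (y≢x refl)
lookup-⁅x⁆-y {x = zero}  {suc y} _   = Vec.lookup-replicate y false
lookup-⁅x⁆-y {x = suc x} {zero}  _   = refl
lookup-⁅x⁆-y {x = suc x} {suc y} y≢x = lookup-⁅x⁆-y (y≢x ∘ cong suc)

member≢nonmember : (p : Subset N) {x y : Fin N} → lookup p x ≡ true → lookup p y ≡ false → x ≢ y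
member≢nonmember _ x∈p y∉p refl = true≡false-elim x∈p y∉p

suc-∣p[x]≔false∣ : (p : Subset N) (x : Fin N) → lookup p x ≡ true →
                   suc ∣ p [ x ]≔ false ∣ ≡ ∣ p ∣
suc-∣p[x]≔false∣ (true  ∷ p) zero    refl = refl
suc-∣p[x]≔false∣ (true  ∷ p) (suc x) x∈p  = cong suc (suc-∣p[x]≔false∣ p x x∈p)
suc-∣p[x]≔false∣ (false ∷ p) (suc x) x∈p  = suc-∣p[x]≔false∣ p x x∈p

∣p[x]≔true∣ : (p : Subset N) (x : Fin N) → lookup p x ≡ false →
              ∣ p [ x ]≔ true ∣ ≡ suc ∣ p ∣
∣p[x]≔true∣ (false ∷ p) zero    refl = refl
∣p[x]≔true∣ (true  ∷ p) (suc x) x∉p  = cong suc (∣p[x]≔true∣ p x x∉p)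
∣p[x]≔true∣ (false ∷ p) (suc x) x∉p  = ∣p[x]≔true∣ p x x∉p

∣p++q∣ : ∀ {m n} (p : Subset m) (q : Subset n) → ∣ p ++ q ∣ ≡ ∣ p ∣ + ∣ q ∣
∣p++q∣ []          q = refl
∣p++q∣ (true  ∷ p) q = cong suc (∣p++q∣ p q)
∣p++q∣ (false ∷ p) q = ∣p++q∣ p q

lookup⇒⊆ : {p q : Subset N} → (∀ x → lookup p x ≡ true → lookup q x ≡ true) → p ⊆ q
lookup⇒⊆ {q = q} p⊆q {x} x∈p = Vec.lookup⇒[]= x q (p⊆q x (Vec.[]=⇒lookup x∈p))

⊆∧∣q∣≤∣p∣⇒≡ : {p q : Subset N} → p ⊆ q → ∣ q ∣ ≤ ∣ p ∣ → p ≡ q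
⊆∧∣q∣≤∣p∣⇒≡ {p = []}        {[]}        _   _ = refl
⊆∧∣q∣≤∣p∣⇒≡ {p = true  ∷ p} {true  ∷ q} p⊆q c =
  cong (true ∷_) (⊆∧∣q∣≤∣p∣⇒≡ (drop-∷-⊆ p⊆q) (s≤s⁻¹ c))
⊆∧∣q∣≤∣p∣⇒≡ {p = true  ∷ p} {false ∷ q} p⊆q _ with () ← p⊆q here
⊆∧∣q∣≤∣p∣⇒≡ {p = false ∷ p} {true  ∷ q} p⊆q c =
  ⊥-elim (ℕ.<⇒≱ (s≤s (p⊆q⇒∣p∣≤∣q∣ (drop-∷-⊆ p⊆q))) c)
⊆∧∣q∣≤∣p∣⇒≡ {p = false ∷ p} {false ∷ q} p⊆q c =
  cong (false ∷_) (⊆∧∣q∣≤∣p∣⇒≡ (drop-∷-⊆ p⊆q) c)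

nonempty : (p : Subset N) → 1 ≤ ∣ p ∣ → ∃[ x ] lookup p x ≡ true
nonempty (true  ∷ p) _ = zero , refl
nonempty (false ∷ p) c with x , x∈p ← nonempty p c = suc x , x∈p

another-member : (p : Subset N) {x : Fin N} → 2 ≤ ∣ p ∣ → lookup p x ≡ true →
                 ∃[ y ] y ≢ x × lookup p y ≡ true
another-member p {x} 2≤∣p∣ x∈p
  with y , y∈p′ ← nonempty (p [ x ]≔ false) (s≤s⁻¹ (subst (2 ≤_) (sym (suc-∣p[x]≔false∣ p x x∈p)) 2≤∣p∣))
  with y ≟ x
... | yes refl = true≡false-elim y∈p′ (Vec.lookup∘update x p false)
... | no  y≢x  = y , y≢x , trans (sym (Vec.lookup∘update′ y≢x p false)) y∈p′

injection⇒≤∣p∣ : ∀ n (p : Subset N) (f : Fin n → Fin N) → (∀ {i j} → f i ≡ f j → i ≡ j) →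
                 (∀ i → lookup p (f i) ≡ true) → n ≤ ∣ p ∣
injection⇒≤∣p∣ zero    p f _     _   = z≤n
injection⇒≤∣p∣ (suc n) p f f-inj f∈p =
  subst (suc n ≤_) (suc-∣p[x]≔false∣ p (f zero) (f∈p zero))
    (s≤s (injection⇒≤∣p∣ n (p [ f zero ]≔ false) (f ∘ suc) (suc-injective ∘ f-inj) f∈p′))
  where
  f∈p′ : ∀ i → lookup (p [ f zero ]≔ false) (f (suc i)) ≡ true
  f∈p′ i = trans (Vec.lookup∘update′ (λ e → 0≢1+n (f-inj (sym e))) p false) (f∈p (suc i))

_[_↦_] : Subset N → Fin N → Fin N → Subset N
p [ u ↦ v ] = p [ u ]≔ false [ v ]≔ true

record Swap (X Y : Subset N) (u v : Fin N) : Set where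
  field
    u∈X   : lookup X u ≡ true
    u∉Y   : lookup Y u ≡ false
    v∈Y   : lookup Y v ≡ true
    v∉X   : lookup X v ≡ false
    agree : ∀ w → w ≢ u → w ≢ v → lookup Y w ≡ lookup X w
open Swap

private variable
  X Y Z : Subset N
  u v w : Fin N

Swap-sym : Swap X Y u v → Swap Y X v u
Swap-sym s = record
  { u∈X = v∈Y s ; u∉Y = v∉X s ; v∈Y = u∈X s ; v∉X = u∉Y s
  ; agree = λ w w≢v w≢u → sym (agree s w w≢u w≢v) }

Swap-keeps : Swap X Y u v → w ≢ u → lookup X w ≡ true → lookup Y w ≡ true
Swap-keeps {X = X} {w = w} s w≢u w∈X =
  trans (agree s w w≢u (member≢nonmember X w∈X (v∉X s))) w∈X

Swap-avoids : Swap X Y u v → w ≢ v → lookup X w ≡ false → lookup Y w ≡ false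
Swap-avoids {X = X} {w = w} s w≢v w∉X =
  trans (agree s w (member≢nonmember X (u∈X s) w∉X ∘ sym) w≢v) w∉X

Swap-member : Swap X Y u v → lookup Y w ≡ true → w ≡ v ⊎ (w ≢ u × lookup X w ≡ true)
Swap-member {Y = Y} {u = u} {v = v} {w = w} s w∈Y with w ≟ v
... | yes w≡v = inj₁ w≡v
... | no  w≢v = inj₂ (w≢u , trans (sym (agree s w w≢u w≢v)) w∈Y)
  where
  w≢u : w ≢ u
  w≢u = member≢nonmember Y w∈Y (u∉Y s)

Swap-removed-unique : Swap X Y u v → lookup X w ≡ true → lookup Y w ≡ false → w ≡ u
Swap-removed-unique {u = u} {w = w} s w∈X w∉Y with w ≟ u
... | yes w≡u = w≡u
... | no  w≢u = true≡false-elim (Swap-keeps s w≢u w∈X) w∉Y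

Swap-added-unique : Swap X Y u v → lookup Y w ≡ true → lookup X w ≡ false → w ≡ v
Swap-added-unique s = Swap-removed-unique (Swap-sym s)

Swap-functional : {Y′ : Subset N} → Swap X Y u v → Swap X Y′ u v → Y ≡ Y′
Swap-functional {Y = Y} {u = u} {v} {Y′} s s′ = lookup-ext pointwise
  where
  pointwise : ∀ w → lookup Y w ≡ lookup Y′ w
  pointwise w with w ≟ u | w ≟ v
  ... | yes refl | _        = trans (u∉Y s) (sym (u∉Y s′))
  ... | no _     | yes refl = trans (v∈Y s) (sym (v∈Y s′))
  ... | no w≢u   | no w≢v   = trans (agree s w w≢u w≢v) (sym (agree s′ w w≢u w≢v))

Swap-∘ : {a b c : Fin N} → Swap X Y a b → Swap Y Z b c → a ≢ c → Swap X Z a c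
Swap-∘ {X = X} {Y = Y} {Z = Z} {a = a} {b} {c} s t a≢c = record
  { u∈X = u∈X s
  ; u∉Y = Swap-avoids t a≢c (u∉Y s)
  ; v∈Y = v∈Y t
  ; v∉X = trans (sym (agree s c (a≢c ∘ sym) (member≢nonmember Y (v∈Y s) (v∉X t) ∘ sym))) (v∉X t)
  ; agree = agree-XZ }
  where
  agree-XZ : ∀ w → w ≢ a → w ≢ c → lookup Z w ≡ lookup X w
  agree-XZ w w≢a w≢c with w ≟ b
  ... | yes refl = trans (u∉Y t) (sym (v∉X s))
  ... | no  w≢b  = trans (agree t w w≢b w≢c) (agree s w w≢a w≢b)

Swap-restore : {a b d : Fin N} → Swap X Y a b → Swap Y Z d a → d ≢ b → Swap X Z d b
Swap-restore {X = X} {Z = Z} {a = a} {b} {d} s t d≢b = record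
  { u∈X = Swap-keeps (Swap-sym s) d≢b (u∈X t)
  ; u∉Y = u∉Y t
  ; v∈Y = Swap-keeps t (d≢b ∘ sym) (v∈Y s)
  ; v∉X = v∉X s
  ; agree = agree-XZ }
  where
  agree-XZ : ∀ w → w ≢ d → w ≢ b → lookup Z w ≡ lookup X w
  agree-XZ w w≢d w≢b with w ≟ a
  ... | yes refl = trans (v∈Y t) (sym (u∈X s))
  ... | no  w≢a  = trans (agree t w w≢d w≢a) (agree s w w≢a w≢b)

Swap-[↦] : (X : Subset N) → lookup X u ≡ true → lookup X v ≡ false → Swap X (X [ u ↦ v ]) u v
Swap-[↦] {u = u} {v = v} X u∈X v∉X = record
  { u∈X = u∈X
  ; u∉Y = trans (Vec.lookup∘update′ (member≢nonmember X u∈X v∉X) (X [ u ]≔ false) true)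
                (Vec.lookup∘update u X false)
  ; v∈Y = Vec.lookup∘update v (X [ u ]≔ false) true
  ; v∉X = v∉X
  ; agree = λ w w≢u w≢v → trans (Vec.lookup∘update′ w≢v (X [ u ]≔ false) true)
                                (Vec.lookup∘update′ w≢u X false) }

∣[↦]∣ : (X : Subset N) → lookup X u ≡ true → lookup X v ≡ false → ∣ X [ u ↦ v ] ∣ ≡ ∣ X ∣
∣[↦]∣ {u = u} {v = v} X u∈X v∉X = begin
  ∣ X [ u ]≔ false [ v ]≔ true ∣ ≡⟨ ∣p[x]≔true∣ (X [ u ]≔ false) v v∉X′ ⟩
  suc ∣ X [ u ]≔ false ∣         ≡⟨ suc-∣p[x]≔false∣ X u u∈X ⟩
  ∣ X ∣                          ∎
  where
  open ≡-Reasoning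
  v∉X′ : lookup (X [ u ]≔ false) v ≡ false
  v∉X′ = trans (Vec.lookup∘update′ (member≢nonmember X u∈X v∉X ∘ sym) X false) v∉X

private
  difference-true : ∀ {a b} → (if b then false else a) ≡ true → a ≡ true × b ≡ false
  difference-true {true}  {false} _ = refl , refl
  difference-true {false} {false} ()
  difference-true {_}     {true}  ()

  difference-false : ∀ {a b} → (if b then false else a) ≡ false →
                     (if a then false else b) ≡ false → b ≡ a
  difference-false {true}  {true}  _ _ = refl
  difference-false {false} {false} _ _ = refl

  difference-self : ∀ a → (if a then false else a) ≡ false
  difference-self true  = refl
  difference-self false = refl

─≡⁅⁆⇒Swap : X ─ Y ≡ ⁅ u ⁆ → Y ─ X ≡ ⁅ v ⁆ → Swap X Y u v
─≡⁅⁆⇒Swap {X = X} {Y} {u} {v} X─Y Y─X = record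
  { u∈X = proj₁ at-u ; u∉Y = proj₂ at-u ; v∈Y = proj₁ at-v ; v∉X = proj₂ at-v
  ; agree = λ w w≢u w≢v → difference-false (trans (only-X w) (lookup-⁅x⁆-y w≢u))
                                            (trans (only-Y w) (lookup-⁅x⁆-y w≢v)) }
  where
  only-X : ∀ w → (if lookup Y w then false else lookup X w) ≡ lookup ⁅ u ⁆ w
  only-X w = trans (sym (lookup-─ X Y w)) (cong (λ p → lookup p w) X─Y)
  only-Y : ∀ w → (if lookup X w then false else lookup Y w) ≡ lookup ⁅ v ⁆ w
  only-Y w = trans (sym (lookup-─ Y X w)) (cong (λ p → lookup p w) Y─X)
  at-u : lookup X u ≡ true × lookup Y u ≡ false
  at-u = difference-true (trans (only-X u) (lookup-⁅x⁆-x u))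
  at-v : lookup Y v ≡ true × lookup X v ≡ false
  at-v = difference-true (trans (only-Y v) (lookup-⁅x⁆-x v))

Swap⇒─≡⁅⁆ : Swap X Y u v → X ─ Y ≡ ⁅ u ⁆
Swap⇒─≡⁅⁆ {X = X} {Y} {u} {v} s = lookup-ext pointwise
  where
  pointwise : ∀ w → lookup (X ─ Y) w ≡ lookup ⁅ u ⁆ w
  pointwise w rewrite lookup-─ X Y w with w ≟ u
  ... | yes refl rewrite u∉Y s | u∈X s | lookup-⁅x⁆-x u = refl
  ... | no  w≢u rewrite lookup-⁅x⁆-y w≢u with w ≟ v
  ...   | yes refl rewrite v∈Y s = refl
  ...   | no  w≢v rewrite agree s w w≢u w≢v = difference-self (lookup X w)

module _ (G : SimpleGraph N) where

  private
    edge-sym : ∀ {x y} → Adj G x y ≡ Adj G y x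
    edge-sym {x} {y} = SimpleGraph.sym G x y

  Swap⇒TSAdj : Swap X Y u v → Adj G u v ≡ true → TSAdj G X Y
  Swap⇒TSAdj {u = u} {v} s uv = u , v , Swap⇒─≡⁅⁆ s , Swap⇒─≡⁅⁆ (Swap-sym s) , uv

  TSAdj⇒Swap : (XY : TSAdj G X Y) → Swap X Y (proj₁ XY) (proj₁ (proj₂ XY))
  TSAdj⇒Swap (_ , _ , X─Y , Y─X , _) = ─≡⁅⁆⇒Swap X─Y Y─X

  TSAdj-sym : TSAdj G X Y → TSAdj G Y X
  TSAdj-sym XY@(_ , _ , _ , _ , uv) = Swap⇒TSAdj (Swap-sym (TSAdj⇒Swap XY)) (trans edge-sym uv)

  TSAdj-irrefl : ¬ TSAdj G X X
  TSAdj-irrefl XX = true≡false-elim (u∈X (TSAdj⇒Swap XX)) (u∉Y (TSAdj⇒Swap XX))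

  TSAdj⇒added-unique : {b b′ : Fin N} → TSAdj G X Y →
    lookup Y b ≡ true → lookup X b ≡ false → lookup Y b′ ≡ true → lookup X b′ ≡ false → b ≡ b′
  TSAdj⇒added-unique {X = X} {Y = Y} XY b∈Y b∉X b′∈Y b′∉X =
    trans (Swap-added-unique s b∈Y b∉X) (sym (Swap-added-unique s b′∈Y b′∉X))
    where
    s : Swap X Y (proj₁ XY) (proj₁ (proj₂ XY))
    s = TSAdj⇒Swap XY

  vertex-nonadjacent : TSVertex k G X → lookup X u ≡ true → lookup X v ≡ true → Adj G u v ≡ false
  vertex-nonadjacent {X = X} {u = u} {v} (independent , _) u∈X v∈X =
    independent u v (Vec.lookup⇒[]= u X u∈X) (Vec.lookup⇒[]= v X v∈X)

  Swap⇒Independent : Independent G X → Swap X Y u v →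
                     (∀ w → w ≢ u → lookup X w ≡ true → Adj G v w ≡ false) → Independent G Y
  Swap⇒Independent {v = v} independent s v≁X x y x∈Y y∈Y
    with Swap-member s (Vec.[]=⇒lookup x∈Y) | Swap-member s (Vec.[]=⇒lookup y∈Y)
  ... | inj₁ refl        | inj₁ refl        = irrefl G v
  ... | inj₁ refl        | inj₂ (y≢u , y∈X) = v≁X y y≢u y∈X
  ... | inj₂ (x≢u , x∈X) | inj₁ refl        = trans edge-sym (v≁X x x≢u x∈X)
  ... | inj₂ (_ , x∈X)   | inj₂ (_ , y∈X)   =
    independent x y (Vec.lookup⇒[]= x _ x∈X) (Vec.lookup⇒[]= y _ y∈X)

  -- The independent k-set X - a - c + b₁ + b₂, reached from Y₁ = X - a + b₁ by trading a
  -- second token c of X for b₂.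
  fork : {a b₁ b₂ : Fin N} {Y₁ Y₂ : Subset N} → 2 ≤ k →
         TSVertex k G X → TSVertex k G Y₁ → TSVertex k G Y₂ →
         Swap X Y₁ a b₁ → Swap X Y₂ a b₂ → Y₁ ≢ Y₂ → ¬ TSAdj G Y₁ Y₂ →
         ∃[ W ] TSVertex k G W × lookup W b₁ ≡ true × lookup W b₂ ≡ true
  fork {k = k} {X = X} {a} {b₁} {b₂} {Y₁} 2≤k vX vY₁ vY₂ s₁ s₂ Y₁≢Y₂ Y₁≁Y₂
    with c , c≢a , c∈X ← another-member X (subst (2 ≤_) (sym (proj₂ vX)) 2≤k) (u∈X s₁) =
    Y₁ [ c ↦ b₂ ] , (independent , card) , Swap-keeps s b₁≢c (v∈Y s₁) , v∈Y s
    where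
    b₁≢b₂ : b₁ ≢ b₂
    b₁≢b₂ refl = Y₁≢Y₂ (Swap-functional s₁ s₂)
    b₁≁b₂ : Adj G b₁ b₂ ≡ false
    b₁≁b₂ with Adj G b₁ b₂ in e
    ... | false = refl
    ... | true  = ⊥-elim (Y₁≁Y₂ (Swap⇒TSAdj (Swap-∘ (Swap-sym s₁) s₂ b₁≢b₂) e))
    b₁≢c : b₁ ≢ c
    b₁≢c refl = true≡false-elim c∈X (v∉X s₁)
    c∈Y₁ : lookup Y₁ c ≡ true
    c∈Y₁ = Swap-keeps s₁ c≢a c∈X
    b₂∉Y₁ : lookup Y₁ b₂ ≡ false
    b₂∉Y₁ = Swap-avoids s₁ (b₁≢b₂ ∘ sym) (v∉X s₂)
    s : Swap Y₁ (Y₁ [ c ↦ b₂ ]) c b₂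
    s = Swap-[↦] Y₁ c∈Y₁ b₂∉Y₁
    b₂≁Y₁ : ∀ w → w ≢ c → lookup Y₁ w ≡ true → Adj G b₂ w ≡ false
    b₂≁Y₁ w _ w∈Y₁ with Swap-member s₁ w∈Y₁
    ... | inj₁ refl        = trans edge-sym b₁≁b₂
    ... | inj₂ (w≢a , w∈X) = vertex-nonadjacent vY₂ (v∈Y s₂) (Swap-keeps s₂ w≢a w∈X)
    independent : Independent G (Y₁ [ c ↦ b₂ ])
    independent = Swap⇒Independent (proj₁ vY₁) s b₂≁Y₁
    card : ∣ Y₁ [ c ↦ b₂ ] ∣ ≡ k
    card = trans (∣[↦]∣ Y₁ c∈Y₁ b₂∉Y₁) (proj₂ vY₁)

  star-leaves≤k : {n : ℕ} → 2 ≤ k → TSVertex k G X →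
    (Y : Fin n → Subset N) → (∀ i → TSVertex k G (Y i)) → (∀ {i j} → Y i ≡ Y j → i ≡ j) →
    (∀ i → TSAdj G X (Y i)) → (∀ i j → ¬ TSAdj G (Y i) (Y j)) →
    (∀ W → TSVertex k G W → W ≡ X ⊎ TSAdj G X W) → n ≤ k
  star-leaves≤k {X = X} {n = n} 2≤k vX Y vY Y-inj X~Y Y≁Y dominating =
    subst (n ≤_) (proj₂ vX) (injection⇒≤∣p∣ n X removed removed-injective (λ i → u∈X (swap i)))
    where
    removed added : Fin n → Fin N
    removed i = proj₁ (X~Y i)
    added   i = proj₁ (proj₂ (X~Y i))
    swap : ∀ i → Swap X (Y i) (removed i) (added i)
    swap i = TSAdj⇒Swap (X~Y i)
    swap′ : ∀ {i j} → removed i ≡ removed j → Swap X (Y j) (removed i) (added j)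
    swap′ {j = j} r = subst (λ a → Swap X (Y j) a (added j)) (sym r) (swap j)
    distinct-removed : ∀ {i j} → i ≢ j → removed i ≢ removed j
    distinct-removed {i} {j} i≢j r
      with W , vW , bᵢ∈W , bⱼ∈W ← fork 2≤k vX (vY i) (vY j) (swap i) (swap′ r) (i≢j ∘ Y-inj) (Y≁Y i j)
      with dominating W vW
    ... | inj₁ refl = true≡false-elim bᵢ∈W (v∉X (swap i))
    ... | inj₂ X~W  = i≢j (Y-inj (Swap-functional (swap i) (subst (Swap X (Y j) (removed i)) bⱼ≡bᵢ (swap′ r))))
      where
      bⱼ≡bᵢ : added j ≡ added i
      bⱼ≡bᵢ = TSAdj⇒added-unique X~W bⱼ∈W (v∉X (swap j)) bᵢ∈W (v∉X (swap i))
    removed-injective : ∀ {i j} → removed i ≡ removed j → i ≡ j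
    removed-injective {i} {j} r with i ≟ j
    ... | yes i≡j = i≡j
    ... | no  i≢j = ⊥-elim (distinct-removed i≢j r)

record DoubleSwap (X₁ X₂ : Subset N) (a d b c : Fin N) : Set where
  field
    a∈X₁ : lookup X₁ a ≡ true
    d∈X₁ : lookup X₁ d ≡ true
    a∉X₂ : lookup X₂ a ≡ false
    d∉X₂ : lookup X₂ d ≡ false
    b∈X₂ : lookup X₂ b ≡ true
    c∈X₂ : lookup X₂ c ≡ true
    b∉X₁ : lookup X₁ b ≡ false
    c∉X₁ : lookup X₁ c ≡ false
    a≢d  : a ≢ d
    b≢c  : b ≢ c
    agree₂ : ∀ w → w ≢ a → w ≢ d → w ≢ b → w ≢ c → lookup X₂ w ≡ lookup X₁ w
open DoubleSwap

private variable
  X₁ X₂ : Subset N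
  a b c d a′ b′ c′ d′ : Fin N

DoubleSwap-sym : DoubleSwap X₁ X₂ a d b c → DoubleSwap X₂ X₁ b c a d
DoubleSwap-sym t = record
  { a∈X₁ = b∈X₂ t ; d∈X₁ = c∈X₂ t ; a∉X₂ = b∉X₁ t ; d∉X₂ = c∉X₁ t
  ; b∈X₂ = a∈X₁ t ; c∈X₂ = d∈X₁ t ; b∉X₁ = a∉X₂ t ; c∉X₁ = d∉X₂ t
  ; a≢d = b≢c t ; b≢c = a≢d t
  ; agree₂ = λ w w≢b w≢c w≢a w≢d → sym (agree₂ t w w≢a w≢d w≢b w≢c) }

common-neighbour-classify : X₁ ≢ X₂ → Swap X₁ Y a b → Swap X₂ Y c d →
  (∃[ p ] ∃[ q ] Swap X₁ X₂ p q) ⊎ DoubleSwap X₁ X₂ a d b c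
common-neighbour-classify {Y = Y} {a = a} {b} {c} {d} X₁≢X₂ s₁ s₂ with d ≟ b | c ≟ a
... | yes refl | yes refl = ⊥-elim (X₁≢X₂ (Swap-functional (Swap-sym s₁) (Swap-sym s₂)))
... | yes refl | no  c≢a  = inj₁ (a , c , Swap-∘ s₁ (Swap-sym s₂) (c≢a ∘ sym))
... | no  d≢b  | yes refl = inj₁ (d , b , Swap-restore s₁ (Swap-sym s₂) d≢b)
... | no  d≢b  | no  c≢a  = inj₂ record
  { a∈X₁ = u∈X s₁
  ; d∈X₁ = Swap-keeps (Swap-sym s₁) d≢b (v∈Y s₂)
  ; a∉X₂ = Swap-avoids (Swap-sym s₂) (c≢a ∘ sym) (u∉Y s₁)
  ; d∉X₂ = v∉X s₂
  ; b∈X₂ = Swap-keeps (Swap-sym s₂) (d≢b ∘ sym) (v∈Y s₁)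
  ; c∈X₂ = u∈X s₂
  ; b∉X₁ = v∉X s₁
  ; c∉X₁ = Swap-avoids (Swap-sym s₁) c≢a (u∉Y s₂)
  ; a≢d  = member≢nonmember Y (v∈Y s₂) (u∉Y s₁) ∘ sym
  ; b≢c  = member≢nonmember Y (v∈Y s₁) (u∉Y s₂)
  ; agree₂ = λ w w≢a w≢d w≢b w≢c → trans (sym (agree s₂ w w≢c w≢d)) (agree s₁ w w≢a w≢b) }

common-neighbour-added : Swap X₁ Y a′ b′ → Swap X₂ Y c′ d′ →
  w ≢ a′ → lookup X₁ w ≡ true → lookup X₂ w ≡ false → w ≡ d′
common-neighbour-added s s′ w≢a′ w∈X₁ w∉X₂ = Swap-added-unique s′ (Swap-keeps s w≢a′ w∈X₁) w∉X₂

DoubleSwap⇒retained : DoubleSwap X₁ X₂ a d b c → Swap X₁ Y a′ b′ → Swap X₂ Y c′ d′ →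
  (a′ ≡ a × d′ ≡ d) ⊎ (a′ ≡ d × d′ ≡ a)
DoubleSwap⇒retained {a = a} {d} {a′ = a′} t s s′ with a′ ≟ a | a′ ≟ d
... | yes refl | _        =
  inj₁ (refl , sym (common-neighbour-added s s′ (a≢d t ∘ sym) (d∈X₁ t) (d∉X₂ t)))
... | no  _    | yes refl =
  inj₂ (refl , sym (common-neighbour-added s s′ (a≢d t) (a∈X₁ t) (a∉X₂ t)))
... | no a′≢a  | no a′≢d  = ⊥-elim (a≢d t (trans
      (common-neighbour-added s s′ (a′≢a ∘ sym) (a∈X₁ t) (a∉X₂ t))
      (sym (common-neighbour-added s s′ (a′≢d ∘ sym) (d∈X₁ t) (d∉X₂ t)))))

module _ (G : SimpleGraph N) where

  DoubleSwap⇒common-neighbour-unique : {Y′ : Subset N} {b₁ c₁ d₁ b₂ c₂ d₂ : Fin N} →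
    DoubleSwap X₁ X₂ a d b c → TSVertex k G Y′ →
    Swap X₁ Y a′ b₁ → Swap X₂ Y c₁ d₁ → Adj G c₁ d₁ ≡ true →
    Swap X₁ Y′ a′ b₂ → Swap X₂ Y′ c₂ d₂ → Y ≡ Y′
  DoubleSwap⇒common-neighbour-unique
    {X₁ = X₁} {a = a} {d} {b} {c} {Y = Y} {a′} {Y′} {b₁} {c₁} {d₁} {b₂} {c₂} {d₂} t vY′ s s′ c₁d₁ r r′ =
    by-added (DoubleSwap⇒retained (DoubleSwap-sym t) s′ s) (DoubleSwap⇒retained (DoubleSwap-sym t) r′ r)
    where
    d₁≡d₂ : d₁ ≡ d₂
    d₁≡d₂ with DoubleSwap⇒retained t s s′ | DoubleSwap⇒retained t r r′
    ... | inj₁ (_ , d₁≡d) | inj₁ (_ , d₂≡d) = trans d₁≡d (sym d₂≡d)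
    ... | inj₂ (_ , d₁≡a) | inj₂ (_ , d₂≡a) = trans d₁≡a (sym d₂≡a)
    ... | inj₁ (a′≡a , _) | inj₂ (a′≡d , _) = ⊥-elim (a≢d t (trans (sym a′≡a) a′≡d))
    ... | inj₂ (a′≡d , _) | inj₁ (a′≡a , _) = ⊥-elim (a≢d t (trans (sym a′≡a) a′≡d))
    same-added : b₁ ≡ b₂ → Y ≡ Y′
    same-added b₁≡b₂ = Swap-functional s (subst (Swap X₁ Y′ a′) (sym b₁≡b₂) r)
    -- c₁ = b₂ and d₁ = d₂ both lie in Y′, yet c₁ d₁ is an edge.
    crossed : c₁ ≡ b₂ → Y ≡ Y′
    crossed c₁≡b₂ = true≡false-elim (subst₂ (λ x y → Adj G x y ≡ true) c₁≡b₂ d₁≡d₂ c₁d₁)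
                                    (vertex-nonadjacent G vY′ (v∈Y r) (v∈Y r′))
    by-added : (c₁ ≡ b × b₁ ≡ c) ⊎ (c₁ ≡ c × b₁ ≡ b) →
               (c₂ ≡ b × b₂ ≡ c) ⊎ (c₂ ≡ c × b₂ ≡ b) → Y ≡ Y′
    by-added (inj₁ (_ , b₁≡c)) (inj₁ (_ , b₂≡c)) = same-added (trans b₁≡c (sym b₂≡c))
    by-added (inj₂ (_ , b₁≡b)) (inj₂ (_ , b₂≡b)) = same-added (trans b₁≡b (sym b₂≡b))
    by-added (inj₁ (c₁≡b , _)) (inj₂ (_ , b₂≡b)) = crossed (trans c₁≡b (sym b₂≡b))
    by-added (inj₂ (c₁≡c , _)) (inj₁ (_ , b₂≡c)) = crossed (trans c₁≡c (sym b₂≡c))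

  DoubleSwap⇒common-neighbours≤2 : {n : ℕ} → DoubleSwap X₁ X₂ a d b c →
    (Y : Fin n → Subset N) → (∀ i → TSVertex k G (Y i)) → (∀ {i j} → Y i ≡ Y j → i ≡ j) →
    (∀ i → TSAdj G X₁ (Y i)) → (∀ i → TSAdj G X₂ (Y i)) → n ≤ 2
  DoubleSwap⇒common-neighbours≤2 {X₁ = X₁} {a = a} {d} {n = n} t Y vY Y-inj X₁~Y X₂~Y = ℕ.≮⇒≥ 2≮n
    where
    removed₁ added₁ added₂ : Fin n → Fin N
    removed₁ i = proj₁ (X₁~Y i)
    added₁   i = proj₁ (proj₂ (X₁~Y i))
    added₂   i = proj₁ (proj₂ (X₂~Y i))
    retained : ∀ i → (removed₁ i ≡ a × added₂ i ≡ d) ⊎ (removed₁ i ≡ d × added₂ i ≡ a)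
    retained i = DoubleSwap⇒retained t (TSAdj⇒Swap G (X₁~Y i)) (TSAdj⇒Swap G (X₂~Y i))
    kept : Fin n → Fin 2
    kept i = [ (λ _ → zero) , (λ _ → suc zero) ]′ (retained i)
    same-removed : ∀ {i j} → kept i ≡ kept j → removed₁ i ≡ removed₁ j
    same-removed {i} {j} eq with retained i | retained j
    ... | inj₁ (aᵢ≡a , _) | inj₁ (aⱼ≡a , _) = trans aᵢ≡a (sym aⱼ≡a)
    ... | inj₂ (aᵢ≡d , _) | inj₂ (aⱼ≡d , _) = trans aᵢ≡d (sym aⱼ≡d)
    ... | inj₁ _          | inj₂ _          with () ← eq
    ... | inj₂ _          | inj₁ _          with () ← eq
    same-kept⇒≡ : ∀ {i j} → kept i ≡ kept j → Y i ≡ Y j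
    same-kept⇒≡ {i} {j} eq = DoubleSwap⇒common-neighbour-unique t (vY j)
      (TSAdj⇒Swap G (X₁~Y i)) (TSAdj⇒Swap G (X₂~Y i)) (proj₂ (proj₂ (proj₂ (proj₂ (X₂~Y i)))))
      (subst (λ r → Swap X₁ (Y j) r (added₁ j)) (sym (same-removed eq)) (TSAdj⇒Swap G (X₁~Y j)))
      (TSAdj⇒Swap G (X₂~Y j))
    2≮n : ¬ 2 < n
    2≮n 2<n with i , j , i<j , eq ← pigeonhole 2<n kept = <⇒≢ i<j (Y-inj (same-kept⇒≡ eq))

  Swap⇒common-neighbour-removes : {p q : Fin N} →
    TSVertex k G X₁ → Swap X₁ X₂ p q → TSAdj G X₂ Y → Swap X₁ Y a b → a ≡ p
  Swap⇒common-neighbour-removes {X₂ = X₂} {Y = Y} {a = a} {p = p} vX₁ t X₂Y@(c , d , _ , _ , cd) s with a ≟ p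
  ... | yes a≡p = a≡p
  ... | no  a≢p = true≡false-elim (subst₂ (λ x y → Adj G x y ≡ true) (sym a≡c) (sym p≡d) cd)
                                  (vertex-nonadjacent G vX₁ (u∈X s) (u∈X t))
    where
    s₂ : Swap X₂ Y c d
    s₂ = TSAdj⇒Swap G X₂Y
    a≡c : a ≡ c
    a≡c = Swap-removed-unique s₂ (Swap-keeps t a≢p (u∈X s)) (u∉Y s)
    p≡d : p ≡ d
    p≡d = Swap-added-unique s₂ (Swap-keeps s (a≢p ∘ sym) (u∈X t)) (u∉Y t)

  Swap⇒no-dominated-K₂,₃ : {p q : Fin N} → 2 ≤ k → TSVertex k G X₁ → Swap X₁ X₂ p q →
    (Y : Fin 3 → Subset N) → (∀ i → TSVertex k G (Y i)) → (∀ {i j} → Y i ≡ Y j → i ≡ j) →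
    (∀ i → TSAdj G X₁ (Y i)) → (∀ i → TSAdj G X₂ (Y i)) → ¬ TSAdj G (Y (# 0)) (Y (# 1)) →
    (∀ W → TSVertex k G W → TSAdj G W (Y (# 2)) ⊎ TSAdj G W X₁) → ⊥
  Swap⇒no-dominated-K₂,₃ {k = k} {X₁ = X₁} {p = p} 2≤k vX₁ t Y vY Y-inj X₁~Y X₂~Y Y₀≁Y₁ dominated =
    refute (fork G 2≤k vX₁ (vY (# 0)) (vY (# 1)) (swap (# 0)) (swap (# 1)) (0≢1+n ∘ Y-inj) Y₀≁Y₁)
    where
    added : Fin 3 → Fin N
    added i = proj₁ (proj₂ (X₁~Y i))
    swap : ∀ i → Swap X₁ (Y i) p (added i)
    swap i = subst (λ a → Swap X₁ (Y i) a (added i))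
                   (Swap⇒common-neighbour-removes vX₁ t (X₂~Y i) (TSAdj⇒Swap G (X₁~Y i)))
                   (TSAdj⇒Swap G (X₁~Y i))
    added-injective : ∀ {i j} → added i ≡ added j → i ≡ j
    added-injective {i} {j} e = Y-inj (Swap-functional (swap i) (subst (Swap X₁ (Y j) p) (sym e) (swap j)))
    added∉Y₂ : ∀ i → i ≢ # 2 → lookup (Y (# 2)) (added i) ≡ false
    added∉Y₂ i i≢2 = Swap-avoids (swap (# 2)) (i≢2 ∘ added-injective) (v∉X (swap i))
    refute : (∃[ W ] TSVertex k G W × lookup W (added (# 0)) ≡ true × lookup W (added (# 1)) ≡ true) →
             ⊥
    refute (W , vW , b₀∈W , b₁∈W) with dominated W vW
    ... | inj₁ W~Y₂ = 0≢1+n (added-injective (TSAdj⇒added-unique G (TSAdj-sym G W~Y₂)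
                        b₀∈W (added∉Y₂ (# 0) (λ ())) b₁∈W (added∉Y₂ (# 1) (λ ()))))
    ... | inj₂ W~X₁ = 0≢1+n (added-injective (TSAdj⇒added-unique G (TSAdj-sym G W~X₁)
                        b₀∈W (v∉X (swap (# 0))) b₁∈W (v∉X (swap (# 1)))))

  no-dominated-K₂,₃ : 2 ≤ k → TSVertex k G X₁ → X₁ ≢ X₂ →
    (Y : Fin 3 → Subset N) → (∀ i → TSVertex k G (Y i)) → (∀ {i j} → Y i ≡ Y j → i ≡ j) →
    (∀ i → TSAdj G X₁ (Y i)) → (∀ i → TSAdj G X₂ (Y i)) → ¬ TSAdj G (Y (# 0)) (Y (# 1)) →
    (∀ W → TSVertex k G W → TSAdj G W (Y (# 2)) ⊎ TSAdj G W X₁) → ⊥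
  no-dominated-K₂,₃ 2≤k vX₁ X₁≢X₂ Y vY Y-inj X₁~Y X₂~Y Y₀≁Y₁ dominated
    with common-neighbour-classify X₁≢X₂ (TSAdj⇒Swap G (X₁~Y (# 0))) (TSAdj⇒Swap G (X₂~Y (# 0)))
  ... | inj₁ (_ , _ , t) = Swap⇒no-dominated-K₂,₃ 2≤k vX₁ t Y vY Y-inj X₁~Y X₂~Y Y₀≁Y₁ dominated
  ... | inj₂ t = ℕ.<⇒≱ ℕ.≤-refl (DoubleSwap⇒common-neighbours≤2 t Y vY Y-inj X₁~Y X₂~Y)

↑ˡ⊎↑ʳ : ∀ m {n} (z : Fin (m + n)) → (∃[ x ] x ↑ˡ n ≡ z) ⊎ (∃[ y ] m ↑ʳ y ≡ z)
↑ˡ⊎↑ʳ m z with splitAt m z in eq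
... | inj₁ x = inj₁ (x , splitAt⁻¹-↑ˡ eq)
... | inj₂ y = inj₂ (y , splitAt⁻¹-↑ʳ eq)

↑ˡ≢↑ʳ : ∀ {m n} (x : Fin m) (y : Fin n) → x ↑ˡ n ≢ m ↑ʳ y
↑ˡ≢↑ʳ {m} {n} x y e
  with () ← trans (sym (splitAt-↑ˡ m x n)) (trans (cong (splitAt m) e) (splitAt-↑ʳ m n y))

toℕ<ᵇ : ∀ {m} (x : Fin m) → (toℕ x <ᵇ m) ≡ true
toℕ<ᵇ {suc m} zero    = refl
toℕ<ᵇ {suc m} (suc x) = toℕ<ᵇ x

m+n<ᵇm : ∀ m n → (m + n <ᵇ m) ≡ false
m+n<ᵇm zero    n = refl
m+n<ᵇm (suc m) n = m+n<ᵇm m n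

module _ {m n : ℕ} where

  K-adj-↑ˡ↑ʳ : (x : Fin m) (y : Fin n) → Adj (K m n) (x ↑ˡ n) (m ↑ʳ y) ≡ true
  K-adj-↑ˡ↑ʳ x y rewrite toℕ-↑ˡ x n | toℕ-↑ʳ m y | toℕ<ᵇ x | m+n<ᵇm m (toℕ y) = refl

  K-adj-↑ʳ↑ˡ : (y : Fin n) (x : Fin m) → Adj (K m n) (m ↑ʳ y) (x ↑ˡ n) ≡ true
  K-adj-↑ʳ↑ˡ y x rewrite toℕ-↑ˡ x n | toℕ-↑ʳ m y | toℕ<ᵇ x | m+n<ᵇm m (toℕ y) = refl

  K-adj-↑ʳ↑ʳ : (y y′ : Fin n) → Adj (K m n) (m ↑ʳ y) (m ↑ʳ y′) ≡ false
  K-adj-↑ʳ↑ʳ y y′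
    rewrite toℕ-↑ʳ m y | toℕ-↑ʳ m y′ | m+n<ᵇm m (toℕ y) | m+n<ᵇm m (toℕ y′) = refl

K₁ₙ-reconf⇒n≤k : {n : ℕ} → 2 ≤ k → IsTSReconf k (K 1 n) → n ≤ k
K₁ₙ-reconf⇒n≤k {k = k} 2≤k (_ , G , f , vertex , f-injective , f-surjective , f-adj) =
  star-leaves≤k G 2≤k (vertex zero) (f ∘ suc) (vertex ∘ suc) (suc-injective ∘ f-injective _ _)
    (λ i → proj₁ (f-adj zero (suc i)) refl)
    (λ i j leaves-adj → true≡false-elim (proj₂ (f-adj (suc i) (suc j)) leaves-adj) refl)
    dominating
  where
  dominating : ∀ W → TSVertex k G W → W ≡ f zero ⊎ TSAdj G (f zero) W
  dominating W vW with f-surjective W vW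
  ... | zero  , refl = inj₁ refl
  ... | suc i , refl = inj₂ (proj₁ (f-adj zero (suc i)) refl)

Kₘₙ-reconf⇒n≤2 : {m n : ℕ} → 2 ≤ k → 2 ≤ m → IsTSReconf k (K m n) → n ≤ 2
Kₘₙ-reconf⇒n≤2 {k = k} {m} {n} 2≤k (s≤s (s≤s _))
  (N , G , f , vertex , f-injective , f-surjective , f-adj) = ℕ.≮⇒≥ 2≮n
  where
  2≮n : ¬ 2 < n
  2≮n 3≤n = no-dominated-K₂,₃ G 2≤k (vertex (left zero)) (0≢1+n ∘ ↑ˡ-injective n _ _ ∘ f-injective _ _)
    Y₀₁₂ (vertex ∘ right ∘ three) (inject≤-injective 3≤n 3≤n _ _ ∘ ↑ʳ-injective m _ _ ∘ f-injective _ _)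
    (λ i → proj₁ (f-adj (left zero) (right (three i))) (K-adj-↑ˡ↑ʳ {m} {n} zero (three i)))
    (λ i → proj₁ (f-adj (left (suc zero)) (right (three i))) (K-adj-↑ˡ↑ʳ {m} {n} (suc zero) (three i)))
    (λ Y₀~Y₁ → true≡false-elim (proj₂ (f-adj (right (three (# 0))) (right (three (# 1)))) Y₀~Y₁)
                               (K-adj-↑ʳ↑ʳ {m} {n} (three (# 0)) (three (# 1))))
    dominated
    where
    left : Fin m → Fin (m + n)
    left x = x ↑ˡ n
    right : Fin n → Fin (m + n)
    right y = m ↑ʳ y
    three : Fin 3 → Fin n
    three i = inject≤ i 3≤n
    Y₀₁₂ : Fin 3 → Subset N
    Y₀₁₂ = f ∘ right ∘ three
    dominated : ∀ W → TSVertex k G W → TSAdj G W (Y₀₁₂ (# 2)) ⊎ TSAdj G W (f (left zero))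
    dominated W vW with f-surjective W vW
    ... | z , refl with ↑ˡ⊎↑ʳ m z
    ...   | inj₁ (x , refl) =
      inj₁ (proj₁ (f-adj (left x) (right (three (# 2)))) (K-adj-↑ˡ↑ʳ {m} {n} x (three (# 2))))
    ...   | inj₂ (y , refl) =
      inj₂ (proj₁ (f-adj (right y) (left zero)) (K-adj-↑ʳ↑ˡ {m} {n} y zero))

does-≟-sym : ∀ {n} (x y : Fin n) → does (x ≟ y) ≡ does (y ≟ x)
does-≟-sym x y with x ≟ y
... | yes refl = sym (dec-true (x ≟ x) refl)
... | no  x≢y  = sym (dec-false (y ≟ x) (x≢y ∘ sym))

module StarConstruction (k n : ℕ) (n≤k : n ≤ k) where

  centre : Fin k → Fin (k + n)
  centre c = c ↑ˡ n

  leaf : Fin n → Fin (k + n)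
  leaf l = k ↑ʳ l

  foot : Fin n → Fin k
  foot l = inject≤ l n≤k

  adjacency : Fin k ⊎ Fin n → Fin k ⊎ Fin n → Bool
  adjacency (inj₁ c) (inj₁ c′) = false
  adjacency (inj₁ c) (inj₂ l)  = does (c ≟ foot l)
  adjacency (inj₂ l) (inj₁ c)  = does (c ≟ foot l)
  adjacency (inj₂ l) (inj₂ l′) = not (does (l ≟ l′))

  adjacency-sym : ∀ x y → adjacency x y ≡ adjacency y x
  adjacency-sym (inj₁ c) (inj₁ c′) = refl
  adjacency-sym (inj₁ c) (inj₂ l)  = refl
  adjacency-sym (inj₂ l) (inj₁ c)  = refl
  adjacency-sym (inj₂ l) (inj₂ l′) = cong not (does-≟-sym l l′)

  adjacency-irrefl : ∀ x → adjacency x x ≡ false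
  adjacency-irrefl (inj₁ c) = refl
  adjacency-irrefl (inj₂ l) = cong not (dec-true (l ≟ l) refl)

  graph : SimpleGraph (k + n)
  graph = record
    { Adj    = λ u v → adjacency (splitAt k u) (splitAt k v)
    ; sym    = λ u v → adjacency-sym (splitAt k u) (splitAt k v)
    ; irrefl = λ u → adjacency-irrefl (splitAt k u)
    }

  centre-centre : ∀ c c′ → Adj graph (centre c) (centre c′) ≡ false
  centre-centre c c′ rewrite splitAt-↑ˡ k c n | splitAt-↑ˡ k c′ n = refl

  leaf-centre : ∀ l c → Adj graph (leaf l) (centre c) ≡ does (c ≟ foot l)
  leaf-centre l c rewrite splitAt-↑ʳ k n l | splitAt-↑ˡ k c n = refl

  leaf-leaf : ∀ l l′ → Adj graph (leaf l) (leaf l′) ≡ not (does (l ≟ l′))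
  leaf-leaf l l′ rewrite splitAt-↑ʳ k n l | splitAt-↑ʳ k n l′ = refl

  foot-injective : ∀ {l l′} → foot l ≡ foot l′ → l ≡ l′
  foot-injective = inject≤-injective n≤k n≤k _ _

  centres : Subset (k + n)
  centres = ⊤ {k} ++ ∅ {n}

  centre∈centres : ∀ c → lookup centres (centre c) ≡ true
  centre∈centres c = trans (Vec.lookup-++ˡ (⊤ {k}) (∅ {n}) c) (Vec.lookup-replicate c true)

  leaf∉centres : ∀ l → lookup centres (leaf l) ≡ false
  leaf∉centres l = trans (Vec.lookup-++ʳ (⊤ {k}) (∅ {n}) l) (Vec.lookup-replicate l false)

  ∣centres∣ : ∣ centres ∣ ≡ k
  ∣centres∣ = begin
    ∣ ⊤ {k} ++ ∅ {n} ∣    ≡⟨ ∣p++q∣ (⊤ {k}) (∅ {n}) ⟩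
    ∣ ⊤ {k} ∣ + ∣ ∅ {n} ∣ ≡⟨ cong₂ _+_ (∣⊤∣≡n k) (∣⊥∣≡0 n) ⟩
    k + 0                 ≡⟨ ℕ.+-identityʳ k ⟩
    k                     ∎
    where open ≡-Reasoning

  centres-vertex : TSVertex k graph centres
  centres-vertex = independent , ∣centres∣
    where
    independent : Independent graph centres
    independent u v u∈ v∈ with ↑ˡ⊎↑ʳ k u | ↑ˡ⊎↑ʳ k v
    ... | inj₁ (c , refl) | inj₁ (c′ , refl) = centre-centre c c′
    ... | inj₂ (l , refl) | _                = true≡false-elim (Vec.[]=⇒lookup u∈) (leaf∉centres l)
    ... | _               | inj₂ (l , refl)  = true≡false-elim (Vec.[]=⇒lookup v∈) (leaf∉centres l)

  petal : Fin n → Subset (k + n)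
  petal l = centres [ centre (foot l) ↦ leaf l ]

  petal-swap : ∀ l → Swap centres (petal l) (centre (foot l)) (leaf l)
  petal-swap l = Swap-[↦] centres (centre∈centres (foot l)) (leaf∉centres l)

  leaf∉petal : ∀ {l l′} → l ≢ l′ → lookup (petal l′) (leaf l) ≡ false
  leaf∉petal l≢l′ = Swap-avoids (petal-swap _) (l≢l′ ∘ ↑ʳ-injective k _ _) (leaf∉centres _)

  petal-vertex : ∀ l → TSVertex k graph (petal l)
  petal-vertex l = Swap⇒Independent graph (proj₁ centres-vertex) (petal-swap l) leaf≁centres
                 , trans (∣[↦]∣ centres (centre∈centres (foot l)) (leaf∉centres l)) ∣centres∣
    where
    leaf≁centres : ∀ w → w ≢ centre (foot l) → lookup centres w ≡ true → Adj graph (leaf l) w ≡ false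
    leaf≁centres w w≢ w∈ with ↑ˡ⊎↑ʳ k w
    ... | inj₁ (c , refl)  = trans (leaf-centre l c) (dec-false (c ≟ foot l) (w≢ ∘ cong centre))
    ... | inj₂ (l′ , refl) = true≡false-elim w∈ (leaf∉centres l′)

  leaf∈petal : ∀ l → lookup (petal l) (leaf l) ≡ true
  leaf∈petal l = v∈Y (petal-swap l)

  star : Fin (1 + n) → Subset (k + n)
  star zero    = centres
  star (suc l) = petal l

  star-vertex : ∀ x → TSVertex k graph (star x)
  star-vertex zero    = centres-vertex
  star-vertex (suc l) = petal-vertex l

  leaf∈star⇒≡ : ∀ x l → lookup (star x) (leaf l) ≡ true → x ≡ suc l
  leaf∈star⇒≡ zero     l leaf∈ = true≡false-elim leaf∈ (leaf∉centres l)
  leaf∈star⇒≡ (suc l′) l leaf∈ with l′ ≟ l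
  ... | yes refl = refl
  ... | no  l′≢l = true≡false-elim leaf∈ (leaf∉petal (l′≢l ∘ sym))

  star-injective : ∀ x y → star x ≡ star y → x ≡ y
  star-injective zero    zero    _ = refl
  star-injective zero    (suc l) e = leaf∈star⇒≡ zero l (subst (λ p → lookup p (leaf l) ≡ true) (sym e) (leaf∈petal l))
  star-injective (suc l) y       e = sym (leaf∈star⇒≡ y l (subst (λ p → lookup p (leaf l) ≡ true) e (leaf∈petal l)))

  -- A vertex containing leaf l contains no other leaf and not its foot, so it lies in petal l.
  star-surjective : ∀ I → TSVertex k graph I → ∃[ x ] star x ≡ I
  star-surjective I vI@(_ , ∣I∣≡k) with any? (λ l → lookup I (leaf l) Data.Bool.≟ true)
  ... | yes (l , leaf∈I) =
    suc l , sym (⊆∧∣q∣≤∣p∣⇒≡ (lookup⇒⊆ I⊆petal) (ℕ.≤-reflexive (trans ∣petal∣ (sym ∣I∣≡k))))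
    where
    ∣petal∣ : ∣ petal l ∣ ≡ k
    ∣petal∣ = proj₂ (petal-vertex l)
    I⊆petal : ∀ w → lookup I w ≡ true → lookup (petal l) w ≡ true
    I⊆petal w w∈I with ↑ˡ⊎↑ʳ k w
    ... | inj₁ (c , refl) with c ≟ foot l
    ...   | yes refl = true≡false-elim (trans (leaf-centre l c) (dec-true (c ≟ c) refl))
                                       (vertex-nonadjacent graph vI leaf∈I w∈I)
    ...   | no  c≢   = Swap-keeps (petal-swap l) (c≢ ∘ ↑ˡ-injective n _ _) (centre∈centres c)
    I⊆petal w w∈I | inj₂ (l′ , refl) with l′ ≟ l
    ...   | yes refl = leaf∈petal l
    ...   | no  l′≢l = true≡false-elim (trans (leaf-leaf l′ l) (cong not (dec-false (l′ ≟ l) l′≢l)))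
                                       (vertex-nonadjacent graph vI w∈I leaf∈I)
  ... | no no-leaf =
    zero , sym (⊆∧∣q∣≤∣p∣⇒≡ (lookup⇒⊆ I⊆centres) (ℕ.≤-reflexive (trans ∣centres∣ (sym ∣I∣≡k))))
    where
    I⊆centres : ∀ w → lookup I w ≡ true → lookup centres w ≡ true
    I⊆centres w w∈I with ↑ˡ⊎↑ʳ k w
    ... | inj₁ (c , refl) = centre∈centres c
    ... | inj₂ (l , refl) = ⊥-elim (no-leaf (l , w∈I))

  centres~petal : ∀ l → TSAdj graph centres (petal l)
  centres~petal l = Swap⇒TSAdj graph (petal-swap l)
    (trans (SimpleGraph.sym graph _ _) (trans (leaf-centre l (foot l)) (dec-true (foot l ≟ foot l) refl)))

  petals-nonadjacent : ∀ l l′ → ¬ TSAdj graph (petal l) (petal l′)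
  petals-nonadjacent l l′ adj with l ≟ l′
  ... | yes refl = TSAdj-irrefl graph adj
  ... | no  l≢l′ = ↑ˡ≢↑ʳ (foot l) l′ (sym (TSAdj⇒added-unique graph adj
                     (leaf∈petal l′) (leaf∉petal (l≢l′ ∘ sym))
                     (Swap-keeps (petal-swap l′) (l≢l′ ∘ foot-injective ∘ ↑ˡ-injective n _ _)
                                 (centre∈centres (foot l)))
                     (u∉Y (petal-swap l))))

  star-adjacency : ∀ x y → (Adj (K 1 n) x y ≡ true → TSAdj graph (star x) (star y))
                         × (TSAdj graph (star x) (star y) → Adj (K 1 n) x y ≡ true)
  star-adjacency zero    zero     = (λ ()) , λ adj → ⊥-elim (TSAdj-irrefl graph adj)
  star-adjacency zero    (suc l)  = (λ _ → centres~petal l) , λ _ → refl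
  star-adjacency (suc l) zero     = (λ _ → TSAdj-sym graph (centres~petal l)) , λ _ → refl
  star-adjacency (suc l) (suc l′) = (λ ()) , λ adj → ⊥-elim (petals-nonadjacent l l′ adj)

  K₁ₙ-reconf : IsTSReconf k (K 1 n)
  K₁ₙ-reconf = k + n , graph , star , star-vertex , star-injective , star-surjective , star-adjacency

-- The independent
-- (2 + j)-sets pick one endpoint of each edge and every isolated vertex; the four choices
-- form a 4-cycle, choices 0, 1 being one side of K_{2,2} and 2, 3 the other.
module TwoEdgesConstruction (j : ℕ) where

  matching : Fin 4 → Fin 4 → Bool
  matching zero                   (suc zero)             = true
  matching (suc zero)             zero                   = true
  matching (suc (suc zero))       (suc (suc (suc zero))) = true
  matching (suc (suc (suc zero))) (suc (suc zero))       = true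
  matching _                      _                      = false

  matching-sym : ∀ a b → matching a b ≡ matching b a
  matching-sym = toWitness {a? = all? λ a → all? λ b → matching a b Data.Bool.≟ matching b a} tt

  matching-irrefl : ∀ a → matching a a ≡ false
  matching-irrefl = toWitness {a? = all? λ a → matching a a Data.Bool.≟ false} tt

  adjacency : Fin 4 ⊎ Fin j → Fin 4 ⊎ Fin j → Bool
  adjacency (inj₁ a) (inj₁ b) = matching a b
  adjacency (inj₁ a) (inj₂ t) = false
  adjacency (inj₂ t) _        = false

  adjacency-sym : ∀ x y → adjacency x y ≡ adjacency y x
  adjacency-sym (inj₁ a) (inj₁ b) = matching-sym a b
  adjacency-sym (inj₁ a) (inj₂ t) = refl
  adjacency-sym (inj₂ t) (inj₁ b) = refl
  adjacency-sym (inj₂ t) (inj₂ u) = refl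

  adjacency-irrefl : ∀ x → adjacency x x ≡ false
  adjacency-irrefl (inj₁ a) = matching-irrefl a
  adjacency-irrefl (inj₂ t) = refl

  graph : SimpleGraph (4 + j)
  graph = record
    { Adj    = λ u v → adjacency (splitAt 4 u) (splitAt 4 v)
    ; sym    = λ u v → adjacency-sym (splitAt 4 u) (splitAt 4 v)
    ; irrefl = λ u → adjacency-irrefl (splitAt 4 u)
    }

  adj-↑ˡ : ∀ a b → Adj graph (a ↑ˡ j) (b ↑ˡ j) ≡ matching a b
  adj-↑ˡ a b rewrite splitAt-↑ˡ 4 a j | splitAt-↑ˡ 4 b j = refl

  adj-↑ʳ : ∀ u t → Adj graph u (4 ↑ʳ t) ≡ false
  adj-↑ʳ u t rewrite splitAt-↑ʳ 4 j t with splitAt 4 u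
  ... | inj₁ _ = refl
  ... | inj₂ _ = refl

  choice : Fin 4 → Subset 4
  choice zero                   = true  ∷ false ∷ true  ∷ false ∷ []
  choice (suc zero)             = false ∷ true  ∷ false ∷ true  ∷ []
  choice (suc (suc zero))       = true  ∷ false ∷ false ∷ true  ∷ []
  choice (suc (suc (suc zero))) = false ∷ true  ∷ true  ∷ false ∷ []

  choice-independent : ∀ x a b → lookup (choice x) a ∧ lookup (choice x) b ∧ matching a b ≡ false
  choice-independent = toWitness {a? = all? λ x → all? λ a → all? λ b →
    lookup (choice x) a ∧ lookup (choice x) b ∧ matching a b Data.Bool.≟ false} tt

  ∣choice∣ : ∀ x → ∣ choice x ∣ ≡ 2
  ∣choice∣ = toWitness {a? = all? λ x → ∣ choice x ∣ ℕ.≟ 2} tt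

  choice-injective : ∀ x y → choice x ≡ choice y → x ≡ y
  choice-injective = toWitness {a? = all? λ x → all? λ y →
    Vec.≡-dec Data.Bool._≟_ (choice x) (choice y) →-dec (x ≟ y)} tt

  square : Fin 4 → Subset (4 + j)
  square x = choice x ++ ⊤

  lookup-square : ∀ x a → lookup (square x) (a ↑ˡ j) ≡ lookup (choice x) a
  lookup-square x a = Vec.lookup-++ˡ (choice x) ⊤ a

  square-vertex : ∀ x → TSVertex (2 + j) graph (square x)
  square-vertex x = independent , trans (∣p++q∣ (choice x) ⊤) (cong₂ _+_ (∣choice∣ x) (∣⊤∣≡n j))
    where
    independent : Independent graph (square x)
    independent u v u∈ v∈ with ↑ˡ⊎↑ʳ 4 u | ↑ˡ⊎↑ʳ 4 v
    ... | _               | inj₂ (t , refl) = adj-↑ʳ u t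
    ... | inj₂ (t , refl) | _               = trans (SimpleGraph.sym graph u v) (adj-↑ʳ v t)
    ... | inj₁ (a , refl) | inj₁ (b , refl) = trans (adj-↑ˡ a b)
      (subst₂ (λ p q → p ∧ q ∧ matching a b ≡ false)
              (trans (sym (lookup-square x a)) (Vec.[]=⇒lookup u∈))
              (trans (sym (lookup-square x b)) (Vec.[]=⇒lookup v∈))
              (choice-independent x a b))

  square-injective : ∀ x y → square x ≡ square y → x ≡ y
  square-injective x y e = choice-injective x y (Vec.++-injectiveˡ (choice x) (choice y) e)

  square-with : ∀ x (t : Subset j) → ∣ t ∣ ≡ j → square x ≡ choice x ++ t
  square-with x t ∣t∣≡j = cong (choice x ++_) (sym (∣p∣≡n⇒p≡⊤ ∣t∣≡j))

  suc-injective² : ∀ {a b} → suc (suc a) ≡ suc (suc b) → a ≡ b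
  suc-injective² = ℕ.suc-injective ∘ ℕ.suc-injective

  no-room : {A : Set} (t : Subset j) (r : ℕ) → ∣ t ∣ ≡ suc r + j → A
  no-room t r ∣t∣≡ = ⊥-elim (ℕ.<⇒≱ (s≤s (ℕ.m≤n+m j r)) (subst (_≤ j) ∣t∣≡ (∣p∣≤n t)))

  square-surjective : ∀ I → TSVertex (2 + j) graph I → ∃[ x ] square x ≡ I
  square-surjective (true  ∷ true  ∷ _     ∷ _     ∷ t) (independent , _)
    with () ← independent (# 0) (# 1) here (there here)
  square-surjective (_     ∷ _     ∷ true  ∷ true  ∷ t) (independent , _)
    with () ← independent (# 2) (# 3) (there (there here)) (there (there (there here)))
  square-surjective (true  ∷ false ∷ true  ∷ false ∷ t) (_ , c) = # 0 , square-with (# 0) t (suc-injective² c)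
  square-surjective (false ∷ true  ∷ false ∷ true  ∷ t) (_ , c) = # 1 , square-with (# 1) t (suc-injective² c)
  square-surjective (true  ∷ false ∷ false ∷ true  ∷ t) (_ , c) = # 2 , square-with (# 2) t (suc-injective² c)
  square-surjective (false ∷ true  ∷ true  ∷ false ∷ t) (_ , c) = # 3 , square-with (# 3) t (suc-injective² c)
  square-surjective (true  ∷ false ∷ false ∷ false ∷ t) (_ , c) = no-room t 0 (ℕ.suc-injective c)
  square-surjective (false ∷ true  ∷ false ∷ false ∷ t) (_ , c) = no-room t 0 (ℕ.suc-injective c)
  square-surjective (false ∷ false ∷ true  ∷ false ∷ t) (_ , c) = no-room t 0 (ℕ.suc-injective c)
  square-surjective (false ∷ false ∷ false ∷ true  ∷ t) (_ , c) = no-room t 0 (ℕ.suc-injective c)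
  square-surjective (false ∷ false ∷ false ∷ false ∷ t) (_ , c) = no-room t 1 c

  Corresponds : Fin 4 → Fin 4 → Set
  Corresponds x y = (Adj (K 2 2) x y ≡ true → TSAdj graph (square x) (square y))
                  × (TSAdj graph (square x) (square y) → Adj (K 2 2) x y ≡ true)

  diagonal : ∀ x → Corresponds x x
  diagonal x = (λ e → true≡false-elim e (irrefl (K 2 2) x)) , (⊥-elim ∘ TSAdj-irrefl graph {X = square x})

  apart : ∀ x y (u v : Fin (4 + j)) → u ≢ v →
    lookup (square y) u ≡ true → lookup (square x) u ≡ false →
    lookup (square y) v ≡ true → lookup (square x) v ≡ false → Adj (K 2 2) x y ≡ false → Corresponds x y
  apart x y u v u≢v u∈ u∉ v∈ v∉ e =
    (λ e′ → true≡false-elim e′ e) , (λ xy → ⊥-elim (u≢v (TSAdj⇒added-unique graph xy u∈ u∉ v∈ v∉)))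

  swapped : ∀ x y (u v : Fin (4 + j)) → lookup (square x) u ≡ true → lookup (square x) v ≡ false →
    Adj graph u v ≡ true → square x [ u ↦ v ] ≡ square y → Adj (K 2 2) x y ≡ true → Corresponds x y
  swapped x y u v u∈ v∉ uv x↦y e =
    (λ _ → subst (TSAdj graph (square x)) x↦y (Swap⇒TSAdj graph (Swap-[↦] (square x) u∈ v∉) uv)) , (λ _ → e)

  square-adjacency : ∀ x y → Corresponds x y
  square-adjacency zero                   zero                   = diagonal (# 0)
  square-adjacency (suc zero)             (suc zero)             = diagonal (# 1)
  square-adjacency (suc (suc zero))       (suc (suc zero))       = diagonal (# 2)
  square-adjacency (suc (suc (suc zero))) (suc (suc (suc zero))) = diagonal (# 3)
  square-adjacency zero                   (suc zero)             = apart (# 0) (# 1) (# 1) (# 3) (λ ()) refl refl refl refl refl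
  square-adjacency (suc zero)             zero                   = apart (# 1) (# 0) (# 0) (# 2) (λ ()) refl refl refl refl refl
  square-adjacency (suc (suc zero))       (suc (suc (suc zero))) = apart (# 2) (# 3) (# 1) (# 2) (λ ()) refl refl refl refl refl
  square-adjacency (suc (suc (suc zero))) (suc (suc zero))       = apart (# 3) (# 2) (# 0) (# 3) (λ ()) refl refl refl refl refl
  square-adjacency zero                   (suc (suc zero))       = swapped (# 0) (# 2) (# 2) (# 3) refl refl refl refl refl
  square-adjacency zero                   (suc (suc (suc zero))) = swapped (# 0) (# 3) (# 0) (# 1) refl refl refl refl refl
  square-adjacency (suc zero)             (suc (suc zero))       = swapped (# 1) (# 2) (# 1) (# 0) refl refl refl refl refl
  square-adjacency (suc zero)             (suc (suc (suc zero))) = swapped (# 1) (# 3) (# 3) (# 2) refl refl refl refl refl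
  square-adjacency (suc (suc zero))       zero                   = swapped (# 2) (# 0) (# 3) (# 2) refl refl refl refl refl
  square-adjacency (suc (suc zero))       (suc zero)             = swapped (# 2) (# 1) (# 0) (# 1) refl refl refl refl refl
  square-adjacency (suc (suc (suc zero))) zero                   = swapped (# 3) (# 0) (# 1) (# 0) refl refl refl refl refl
  square-adjacency (suc (suc (suc zero))) (suc zero)             = swapped (# 3) (# 1) (# 2) (# 3) refl refl refl refl refl

  K₂₂-reconf : IsTSReconf (2 + j) (K 2 2)
  K₂₂-reconf =
    4 + j , graph , square , square-vertex , square-injective , square-surjective , square-adjacency

proposition4 : (k m n : ℕ) → k ≥ 2 → n ≥ m → m ≥ 1 →
    (IsTSReconf k (K m n) ⇔ ((m ≡ 1 × n ≤ k) ⊎ (m ≡ 2 × n ≡ 2)))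
proposition4 k m n 2≤k m≤n 1≤m = mk⇔ (only-if m 1≤m m≤n) (if 2≤k)
  where
  only-if : ∀ m → 1 ≤ m → m ≤ n → IsTSReconf k (K m n) → (m ≡ 1 × n ≤ k) ⊎ (m ≡ 2 × n ≡ 2)
  only-if 1               _ _   reconf = inj₁ (refl , K₁ₙ-reconf⇒n≤k 2≤k reconf)
  only-if m@(suc (suc _)) _ m≤n reconf =
    inj₂ (ℕ.≤-antisym (ℕ.≤-trans m≤n n≤2) 2≤m , ℕ.≤-antisym n≤2 (ℕ.≤-trans 2≤m m≤n))
    where
    2≤m : 2 ≤ m
    2≤m = s≤s (s≤s z≤n)
    n≤2 : n ≤ 2
    n≤2 = Kₘₙ-reconf⇒n≤2 2≤k 2≤m reconf
  if : ∀ {k} → 2 ≤ k → (m ≡ 1 × n ≤ k) ⊎ (m ≡ 2 × n ≡ 2) → IsTSReconf k (K m n)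
  if {k}           _             (inj₁ (refl , n≤k))  = StarConstruction.K₁ₙ-reconf k n n≤k
  if {suc (suc j)} (s≤s (s≤s _)) (inj₂ (refl , refl)) = TwoEdgesConstruction.K₂₂-reconf j
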